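{- For $n\ge 0$ let $f(n)$ be the number of subsets $\{p_1<p_2<\cdots<p_k\}\subseteq\{1,\ldots,n\}$ (including the empty set) such that $p_1+\cdots+p_j\le p_{j+1}$ for all $1\le j\le k-1$, and let $b(n)$ be the number of non-squashing partitions of $n$ into distinct parts. Then for every $n\ge1$ there is a bijection between such subsets with largest element exactly $n$ and non-squashing partitions of $2n$ into distinct parts; in particular $f(n)-f(n-1)=b(2n)$.
   Context: A partition $n=p_1+p_2+\cdots+p_k$ with parts written in nondecreasing order $1\le p_1\le\cdots\le p_k$ is called non-squashing if $p_1+\cdots+p_j\le p_{j+1}$ for all $1\le j\le k-1$. The subsets counted by $f(n)$ correspond to stacks of boxes labeled from $\{1,\dots,n\}$ in which box $i$ weighs $i$ and supports weight $i$, and no box is crushed. -}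

module Defs where

open import Data.Bool using (Bool; true; false; _∧_; T)
open import Data.Nat using (ℕ; zero; suc; _+_; _≤ᵇ_; _<ᵇ_; _≡ᵇ_)
open import Data.List using (List; []; _∷_; map; _++_; length; filterᵇ; applyUpTo)
open import Data.Nat.ListAction using (sum)
open import Data.Product using (Σ)

oneTo : ℕ → List ℕ
oneTo n = applyUpTo suc n

sublists : List ℕ → List (List ℕ)
sublists []       = [] ∷ []
sublists (x ∷ xs) = sublists xs ++ map (x ∷_) (sublists xs)

strictInc : List ℕ → Bool
strictInc []           = true
strictInc (x ∷ [])     = true
strictInc (x ∷ y ∷ ys) = (x <ᵇ y) ∧ strictInc (y ∷ ys)

inRange : ℕ → List ℕ → Bool
inRange n []       = true
inRange n (x ∷ xs) = (1 ≤ᵇ x) ∧ (x ≤ᵇ n) ∧ inRange n xs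

-- non-squashing: p_1 + ... + p_j ≤ p_{j+1} for all j ≥ 1
-- (nsFrom acc xs: acc is the sum of the preceding parts; with acc = 0 the
--  first part has no constraint)
nsFrom : ℕ → List ℕ → Bool
nsFrom acc []       = true
nsFrom acc (x ∷ xs) = (acc ≤ᵇ x) ∧ nsFrom (acc + x) xs

nonSquashing : List ℕ → Bool
nonSquashing = nsFrom 0

-- largest element of a strictly increasing list is exactly n
lastIs : ℕ → List ℕ → Bool
lastIs n []           = false
lastIs n (x ∷ [])     = x ≡ᵇ n
lastIs n (x ∷ y ∷ ys) = lastIs n (y ∷ ys)

isNSSubset : ℕ → List ℕ → Bool
isNSSubset n xs = strictInc xs ∧ inRange n xs ∧ nonSquashing xs

isTopNSSubset : ℕ → List ℕ → Bool
isTopNSSubset n xs = isNSSubset n xs ∧ lastIs n xs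

isNSDistinctPartition : ℕ → List ℕ → Bool
isNSDistinctPartition m xs =
  strictInc xs ∧ inRange m xs ∧ (sum xs ≡ᵇ m) ∧ nonSquashing xs

TopNSSubset : ℕ → Set
TopNSSubset n = Σ (List ℕ) (λ xs → T (isTopNSSubset n xs))

NSDistinctPartition : ℕ → Set
NSDistinctPartition m = Σ (List ℕ) (λ xs → T (isNSDistinctPartition m xs))

f : ℕ → ℕ
f n = length (filterᵇ (isNSSubset n) (sublists (oneTo n)))

-- b(m): number of non-squashing partitions of m into distinct parts
-- (distinct positive parts summing to m are exactly subsets of {1..m} with sum m)
b : ℕ → ℕ
b m = length (filterᵇ (isNSDistinctPartition m) (sublists (oneTo m)))

{-# OPTIONS --safe #-}
-- A subset with largest element n is a stack ys ∷ʳ n with sum ys ≤ n. Replacing the bottom part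
-- n by 2n ∸ sum ys keeps it a stack (the new bottom is at least n) and makes the parts sum to 2n.
-- Conversely, in a non-squashing partition ys ∷ʳ w of 2n we have sum ys ≤ w, hence sum ys ≤ n,
-- and every part y of ys is below n because y + y < sum ys + w = 2n; so w can be lowered to n.
-- For the count, the admissible subsets of {1..n} are those of {1..n-1} together with those whose
-- largest element is n, and the lengths of filtered duplicate-free enumerations are compared by
-- injections into Fin and Cantor–Schröder–Bernstein.
module Submission where

open import Defs
open import Data.Nat using (ℕ; _+_; _*_; _∸_; _≤_)
open import Data.Product using (_×_)
open import Function.Bundles using (_⤖_)
open import Relation.Binary.PropositionalEquality using (_≡_)

open import Data.Bool using (Bool; _∧_; T)
open import Data.Bool.Properties using (T-∧; T-irrelevant)
open import Data.Empty using (⊥-elim)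
open import Data.Fin using (Fin; zero; suc)
open import Data.Fin.Properties using (cantor-schröder-bernstein)
open import Data.List using (List; []; _∷_; _∷ʳ_; map; length; lookup; filterᵇ; initLast; _∷ʳ′_)
open import Data.List.Properties using (filter-accept; filter-reject; ∷-injectiveʳ; applyUpTo-∷ʳ)
open import Data.List.Membership.Propositional using (_∈_)
open import Data.List.Membership.Propositional.Properties
  using (∈-lookup; ∈-filter⁺; ∈-filter⁻; ∈-++⁺ˡ; ∈-++⁺ʳ; ∈-++⁻; ∈-map⁺; ∈-map⁻)
import Data.List.Membership.Setoid.Properties as Membership
open import Data.List.Relation.Binary.Sublist.Propositional as Sublist using (_⊆_; []; _∷_; minimum)
open import Data.List.Relation.Binary.Sublist.Propositional.Properties using (++⁺; ++⁺ʳ)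
open import Data.List.Relation.Unary.All as All using (All; []; _∷_)
import Data.List.Relation.Unary.All.Properties as All
open import Data.List.Relation.Unary.Any as Any using (here; there)
open import Data.List.Relation.Unary.Unique.Propositional using (Unique; []; _∷_)
import Data.List.Relation.Unary.Unique.Propositional.Properties as Unique
open import Data.Nat using (zero; suc; _<_; _≡ᵇ_; s≤s)
open import Data.Nat.ListAction using (sum)
open import Data.Nat.ListAction.Properties using (sum-++)
open import Data.Nat.Properties
open import Data.Product using (Σ; _,_; proj₁; proj₂; map₂)
open import Data.Sum using (_⊎_; inj₁; inj₂; [_,_])
open import Function using (_∘_; const; Equivalence; Injective; _↣_; _↔_; mk↣; mk↔ₛ′; Injection)
open import Function.Construct.Composition using (_↣-∘_)
open import Function.Construct.Identity using (↔-id)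
open import Function.Properties.Inverse using (↔⇒↣; ↔⇒⤖; ↔-sym)
open import Relation.Binary.PropositionalEquality using (refl; sym; trans; cong; subst; setoid; module ≡-Reasoning)
open import Relation.Nullary using (¬_; yes; no)
open import Relation.Nullary.Decidable using (T?)

T-∧⁻ : ∀ {a b} → T (a ∧ b) → T a × T b
T-∧⁻ = Equivalence.to T-∧

T-∧⁺ : ∀ {a b} → T a × T b → T (a ∧ b)
T-∧⁺ = Equivalence.from T-∧

≡-subtype : ∀ {A : Set} {P : A → Bool} {x y : A} {p : T (P x)} {q : T (P y)} →
  x ≡ y → _≡_ {A = Σ A (T ∘ P)} (x , p) (y , q)
≡-subtype refl = cong (_ ,_) (T-irrelevant _ _)

2*n≡n+n : ∀ n → 2 * n ≡ n + n
2*n≡n+n n = cong (n +_) (+-identityʳ n)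

m+m≤2*n⇒m≤n : ∀ {m n} → m + m ≤ 2 * n → m ≤ n
m+m≤2*n⇒m≤n {m} {n} m+m≤2n = *-cancelˡ-≤ 2 (subst (_≤ 2 * n) (sym (2*n≡n+n m)) m+m≤2n)

m+m<2*n⇒m<n : ∀ {m n} → m + m < 2 * n → m < n
m+m<2*n⇒m<n {m} {n} m+m<2n = *-cancelˡ-< 2 m n (subst (_< 2 * n) (sym (2*n≡n+n m)) m+m<2n)

∈⇒≤sum : ∀ {n ns} → n ∈ ns → n ≤ sum ns
∈⇒≤sum {ns = n ∷ ns} (here refl) = m≤m+n n (sum ns)
∈⇒≤sum {ns = m ∷ ns} (there n∈ns) = ≤-trans (∈⇒≤sum n∈ns) (m≤n+m (sum ns) m)

sum-∷ʳ : ∀ ns n → sum (ns ∷ʳ n) ≡ sum ns + n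
sum-∷ʳ ns n = trans (sum-++ ns (n ∷ [])) (cong (sum ns +_) (+-identityʳ n))

module _ {A : Set} where

  replaceLast : (List A → A) → List A → List A
  replaceLast g xs with initLast xs
  ... | []       = []
  ... | ys ∷ʳ′ _ = ys ∷ʳ g ys

  initLast-∷ʳ : ∀ (xs : List A) x → initLast (xs ∷ʳ x) ≡ xs ∷ʳ′ x
  initLast-∷ʳ []       x = refl
  initLast-∷ʳ (y ∷ xs) x rewrite initLast-∷ʳ xs x = refl

  replaceLast-∷ʳ : ∀ g (xs : List A) x → replaceLast g (xs ∷ʳ x) ≡ xs ∷ʳ g xs
  replaceLast-∷ʳ g xs x rewrite initLast-∷ʳ xs x = refl

lookup-injective : ∀ {A : Set} {xs : List A} → Unique xs → ∀ {i j} → lookup xs i ≡ lookup xs j → i ≡ j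
lookup-injective (_ ∷ _)      {zero}  {zero}  _  = refl
lookup-injective (x∉xs ∷ _)   {zero}  {suc j} eq = ⊥-elim (All.lookup x∉xs (∈-lookup j) eq)
lookup-injective (x∉xs ∷ _)   {suc i} {zero}  eq = ⊥-elim (All.lookup x∉xs (∈-lookup i) (sym eq))
lookup-injective (_ ∷ unique) {suc i} {suc j} eq = cong suc (lookup-injective unique eq)

record Enumerates {A : Set} (P : A → Bool) (L : List A) : Set where
  field
    unique   : Unique L
    complete : ∀ {x} → T (P x) → x ∈ L

module _ {A : Set} {P : A → Bool} {L : List A} where

  Fin-length-filter↣ : Unique L → Fin (length (filterᵇ P L)) ↣ Σ A (T ∘ P)
  Fin-length-filter↣ unique = mk↣ {to = to} injective
    where
    to : Fin (length (filterᵇ P L)) → Σ A (T ∘ P)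
    to i = lookup (filterᵇ P L) i , proj₂ (∈-filter⁻ (T? ∘ P) {xs = L} (∈-lookup i))
    injective : Injective _≡_ _≡_ to
    injective = lookup-injective (Unique.filter⁺ (T? ∘ P) unique) ∘ cong proj₁

  ↣Fin-length-filter : (∀ {x} → T (P x) → x ∈ L) → Σ A (T ∘ P) ↣ Fin (length (filterᵇ P L))
  ↣Fin-length-filter complete = mk↣ {to = Any.index ∘ ∈-filtered} injective
    where
    ∈-filtered : ((x , p) : Σ A (T ∘ P)) → x ∈ filterᵇ P L
    ∈-filtered (x , p) = ∈-filter⁺ (T? ∘ P) (complete p) p
    injective : Injective _≡_ _≡_ (Any.index ∘ ∈-filtered)
    injective {x} {y} eq =
      ≡-subtype (Membership.index-injective (setoid A) (∈-filtered x) (∈-filtered y) eq)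

length-filter-cong : ∀ {A B : Set} {P : A → Bool} {Q : B → Bool} {L₁ L₂} →
  Enumerates P L₁ → Enumerates Q L₂ → Σ A (T ∘ P) ↔ Σ B (T ∘ Q) →
  length (filterᵇ P L₁) ≡ length (filterᵇ Q L₂)
length-filter-cong L₁-enum L₂-enum P↔Q =
  cantor-schröder-bernstein (Injection.injective (embed L₁.unique L₂.complete P↔Q))
                            (Injection.injective (embed L₂.unique L₁.complete (↔-sym P↔Q)))
  where
  module L₁ = Enumerates L₁-enum
  module L₂ = Enumerates L₂-enum
  embed : ∀ {A B : Set} {P : A → Bool} {Q : B → Bool} {L₁ L₂} →
    Unique L₁ → (∀ {y} → T (Q y) → y ∈ L₂) → Σ A (T ∘ P) ↔ Σ B (T ∘ Q) →
    Fin (length (filterᵇ P L₁)) ↣ Fin (length (filterᵇ Q L₂))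
  embed unique complete P↔Q = ↣Fin-length-filter complete ↣-∘ (↔⇒↣ P↔Q ↣-∘ Fin-length-filter↣ unique)

module _ {A : Set} (P Q R : A → Bool)
         (split : ∀ x → T (P x) → T (Q x) ⊎ T (R x))
         (Q⇒P : ∀ x → T (Q x) → T (P x)) (R⇒P : ∀ x → T (R x) → T (P x))
         (disjoint : ∀ x → T (Q x) → ¬ T (R x)) where

  length-filter-⊎ : ∀ L → length (filterᵇ P L) ≡ length (filterᵇ Q L) + length (filterᵇ R L)
  length-filter-⊎ [] = refl
  length-filter-⊎ (x ∷ L) with T? (Q x) | T? (R x)
  ... | yes q | yes r = ⊥-elim (disjoint x q r)
  ... | yes q | no ¬r
    rewrite filter-accept (T? ∘ P) {xs = L} (Q⇒P x q) | filter-accept (T? ∘ Q) {xs = L} q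
          | filter-reject (T? ∘ R) {xs = L} ¬r
    = cong suc (length-filter-⊎ L)
  ... | no ¬q | yes r
    rewrite filter-accept (T? ∘ P) {xs = L} (R⇒P x r) | filter-reject (T? ∘ Q) {xs = L} ¬q
          | filter-accept (T? ∘ R) {xs = L} r
    = trans (cong suc (length-filter-⊎ L)) (sym (+-suc _ _))
  ... | no ¬q | no ¬r
    rewrite filter-reject (T? ∘ P) {xs = L} ([ ¬q , ¬r ] ∘ split x)
          | filter-reject (T? ∘ Q) {xs = L} ¬q | filter-reject (T? ∘ R) {xs = L} ¬r
    = length-filter-⊎ L

⊆⇒∈-sublists : ∀ {xs ys} → xs ⊆ ys → xs ∈ sublists ys
⊆⇒∈-sublists [] = here refl
⊆⇒∈-sublists (y Sublist.∷ʳ xs⊆ys) = ∈-++⁺ˡ (⊆⇒∈-sublists xs⊆ys)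
⊆⇒∈-sublists {ys = y ∷ ys} (refl ∷ xs⊆ys) = ∈-++⁺ʳ (sublists ys) (∈-map⁺ (y ∷_) (⊆⇒∈-sublists xs⊆ys))

∈-sublists⇒⊆ : ∀ {xs ys} → xs ∈ sublists ys → xs ⊆ ys
∈-sublists⇒⊆ {ys = []} (here refl) = []
∈-sublists⇒⊆ {ys = y ∷ ys} xs∈ with ∈-++⁻ (sublists ys) xs∈
... | inj₁ xs∈′ = y Sublist.∷ʳ ∈-sublists⇒⊆ xs∈′
... | inj₂ xs∈′ with ∈-map⁻ (y ∷_) xs∈′
...   | zs , zs∈ , refl = refl ∷ ∈-sublists⇒⊆ zs∈

sublists-unique : ∀ {xs} → Unique xs → Unique (sublists xs)
sublists-unique [] = [] ∷ []
sublists-unique {x ∷ xs} (x∉xs ∷ unique) =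
  Unique.++⁺ (sublists-unique unique) (Unique.map⁺ ∷-injectiveʳ (sublists-unique unique)) disjoint
  where
  disjoint : ∀ {v} → ¬ (v ∈ sublists xs × v ∈ map (x ∷_) (sublists xs))
  disjoint (v∈ , v∈′) with ∈-map⁻ (x ∷_) v∈′
  ... | zs , _ , refl = All.lookup x∉xs (Sublist.lookup (∈-sublists⇒⊆ v∈) (here refl)) refl

oneTo-unique : ∀ n → Unique (oneTo n)
oneTo-unique n = Unique.applyUpTo⁺₁ suc n (λ i<j _ → <⇒≢ (s≤s i<j))

InRange : ℕ → ℕ → Set
InRange n x = 1 ≤ x × x ≤ n

inRange⁻ : ∀ {n} xs → T (inRange n xs) → All (InRange n) xs
inRange⁻ []       _ = []
inRange⁻ (x ∷ xs) p =
  let 1≤x , rest = T-∧⁻ p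
      x≤n , p′   = T-∧⁻ rest
  in (≤ᵇ⇒≤ 1 x 1≤x , ≤ᵇ⇒≤ x _ x≤n) ∷ inRange⁻ xs p′

inRange⁺ : ∀ {n} xs → All (InRange n) xs → T (inRange n xs)
inRange⁺ []       []                      = _
inRange⁺ (x ∷ xs) ((1≤x , x≤n) ∷ bounds) = T-∧⁺ (≤⇒≤ᵇ 1≤x , T-∧⁺ (≤⇒≤ᵇ x≤n , inRange⁺ xs bounds))

strictInc-∷ʳ⁻ : ∀ xs {x} → T (strictInc (xs ∷ʳ x)) → T (strictInc xs) × All (_< x) xs
strictInc-∷ʳ⁻ []            _ = _ , []
strictInc-∷ʳ⁻ (y ∷ [])      p = _ , <ᵇ⇒< _ _ (proj₁ (T-∧⁻ p)) ∷ []
strictInc-∷ʳ⁻ (y ∷ y′ ∷ ys) p =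
  let y<y′ , rest      = T-∧⁻ p
      inc , y′∷ys<x = strictInc-∷ʳ⁻ (y′ ∷ ys) rest
  in T-∧⁺ (y<y′ , inc) , <-trans (<ᵇ⇒< y y′ y<y′) (All.head y′∷ys<x) ∷ y′∷ys<x

strictInc-∷ʳ⁺ : ∀ xs {x} → T (strictInc xs) → All (_< x) xs → T (strictInc (xs ∷ʳ x))
strictInc-∷ʳ⁺ []            _   _          = _
strictInc-∷ʳ⁺ (y ∷ [])      _   (y<x ∷ []) = T-∧⁺ (<⇒<ᵇ y<x , _)
strictInc-∷ʳ⁺ (y ∷ y′ ∷ ys) inc (_ ∷ ys<x) =
  let y<y′ , inc′ = T-∧⁻ inc
  in T-∧⁺ (y<y′ , strictInc-∷ʳ⁺ (y′ ∷ ys) inc′ ys<x)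

nsFrom-∷ʳ⁻ : ∀ a xs {x} → T (nsFrom a (xs ∷ʳ x)) → T (nsFrom a xs) × a + sum xs ≤ x
nsFrom-∷ʳ⁻ a []       {x} p = _ , subst (_≤ x) (sym (+-identityʳ a)) (≤ᵇ⇒≤ a x (proj₁ (T-∧⁻ p)))
nsFrom-∷ʳ⁻ a (y ∷ ys) {x} p =
  let a≤y , rest    = T-∧⁻ p
      ns , bound = nsFrom-∷ʳ⁻ (a + y) ys rest
  in T-∧⁺ (a≤y , ns) , subst (_≤ x) (+-assoc a y (sum ys)) bound

nsFrom-∷ʳ⁺ : ∀ a xs {x} → T (nsFrom a xs) → a + sum xs ≤ x → T (nsFrom a (xs ∷ʳ x))
nsFrom-∷ʳ⁺ a []       {x} _  bound = T-∧⁺ (≤⇒≤ᵇ (subst (_≤ x) (+-identityʳ a) bound) , _)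
nsFrom-∷ʳ⁺ a (y ∷ ys) {x} ns bound =
  let a≤y , ns′ = T-∧⁻ ns
  in T-∧⁺ (a≤y , nsFrom-∷ʳ⁺ (a + y) ys ns′ (subst (_≤ x) (sym (+-assoc a y (sum ys))) bound))

lastIs-∷ʳ : ∀ {n} xs {x} → lastIs n (xs ∷ʳ x) ≡ (x ≡ᵇ n)
lastIs-∷ʳ []            = refl
lastIs-∷ʳ (y ∷ [])      = refl
lastIs-∷ʳ (y ∷ y′ ∷ ys) = lastIs-∷ʳ (y′ ∷ ys)

-- ys ∷ʳ z is a strictly increasing non-squashing list of positive parts: the boxes ys stacked
-- on the bottom box z.
record Stack (ys : List ℕ) (z : ℕ) : Set where
  field
    increasing      : T (strictInc ys)
    squashFree      : T (nonSquashing ys)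
    positive        : All (1 ≤_) ys
    below           : All (_< z) ys
    carries         : sum ys ≤ z
    bottom-positive : 1 ≤ z

Stack-mono : ∀ {ys z z′} → Stack ys z → z ≤ z′ → Stack ys z′
Stack-mono s z≤z′ = record
  { increasing      = increasing
  ; squashFree      = squashFree
  ; positive        = positive
  ; below           = All.map (λ y<z → <-≤-trans y<z z≤z′) below
  ; carries         = ≤-trans carries z≤z′
  ; bottom-positive = ≤-trans bottom-positive z≤z′
  }
  where open Stack s

Stack-halve : ∀ {ys w n} → Stack ys w → sum ys + w ≡ 2 * n → Stack ys n
Stack-halve {ys} {w} {n} s sum≡2n = record
  { increasing      = increasing
  ; squashFree      = squashFree
  ; positive        = positive
  ; below           = All.tabulate (λ y∈ys → m+m<2*n⇒m<n (≤-trans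
                        (+-mono-≤-< (∈⇒≤sum y∈ys) (All.lookup below y∈ys)) ≤2n))
  ; carries         = m+m≤2*n⇒m≤n (≤-trans (+-monoʳ-≤ (sum ys) carries) ≤2n)
  ; bottom-positive = m+m<2*n⇒m<n (≤-trans bottom-positive (≤-trans (m≤n+m w (sum ys)) ≤2n))
  }
  where
  open Stack s
  ≤2n : sum ys + w ≤ 2 * n
  ≤2n = ≤-reflexive sum≡2n

isNSSubset⁻ : ∀ {n} xs → T (isNSSubset n xs) → T (strictInc xs) × All (InRange n) xs × T (nonSquashing xs)
isNSSubset⁻ {n} xs p =
  let inc , rest   = T-∧⁻ {strictInc xs} p
      bounded , ns = T-∧⁻ {inRange n xs} rest
  in inc , inRange⁻ xs bounded , ns

isNSSubset⁺ : ∀ {n} xs → T (strictInc xs) → All (InRange n) xs → T (nonSquashing xs) → T (isNSSubset n xs)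
isNSSubset⁺ {n} xs inc bounds ns = T-∧⁺ {strictInc xs} (inc , T-∧⁺ {inRange n xs} (inRange⁺ xs bounds , ns))

isNSSubset-mono : ∀ {m n} → m ≤ n → ∀ xs → T (isNSSubset m xs) → T (isNSSubset n xs)
isNSSubset-mono m≤n xs p =
  let inc , bounds , ns = isNSSubset⁻ xs p
  in isNSSubset⁺ xs inc (All.map (map₂ (λ x≤m → ≤-trans x≤m m≤n)) bounds) ns

isNSSubset-∷ʳ⁻ : ∀ {n} ys {z} → T (isNSSubset n (ys ∷ʳ z)) → Stack ys z × z ≤ n
isNSSubset-∷ʳ⁻ ys p =
  let inc , bounds , ns            = isNSSubset⁻ (ys ∷ʳ _) p
      increasing , below           = strictInc-∷ʳ⁻ ys inc
      ys-bounds , (1≤z , z≤bound) = All.∷ʳ⁻ bounds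
      squashFree , carries         = nsFrom-∷ʳ⁻ 0 ys ns
  in record
       { increasing      = increasing
       ; squashFree      = squashFree
       ; positive        = All.map proj₁ ys-bounds
       ; below           = below
       ; carries         = carries
       ; bottom-positive = 1≤z
       } , z≤bound

isNSSubset-∷ʳ⁺ : ∀ {n ys z} → Stack ys z → z ≤ n → T (isNSSubset n (ys ∷ʳ z))
isNSSubset-∷ʳ⁺ {ys = ys} {z} s z≤bound =
  isNSSubset⁺ (ys ∷ʳ z) (strictInc-∷ʳ⁺ ys increasing below)
    (All.∷ʳ⁺ (All.zip (positive , All.map (λ y<z → <⇒≤ (<-≤-trans y<z z≤bound)) below))
             (bottom-positive , z≤bound))
    (nsFrom-∷ʳ⁺ 0 ys squashFree carries)
  where open Stack s

isTopNSSubset-∷ʳ⁻ : ∀ {n} ys {z} → T (isTopNSSubset n (ys ∷ʳ z)) → Stack ys z × z ≡ n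
isTopNSSubset-∷ʳ⁻ {n} ys {z} p =
  let sub , last = T-∧⁻ {isNSSubset n (ys ∷ʳ z)} p
  in proj₁ (isNSSubset-∷ʳ⁻ ys sub) , ≡ᵇ⇒≡ z n (subst T (lastIs-∷ʳ ys) last)

isTopNSSubset-∷ʳ⁺ : ∀ {n ys} → Stack ys n → T (isTopNSSubset n (ys ∷ʳ n))
isTopNSSubset-∷ʳ⁺ {n} {ys} s =
  T-∧⁺ {isNSSubset n (ys ∷ʳ n)} (isNSSubset-∷ʳ⁺ s ≤-refl , subst T (sym (lastIs-∷ʳ ys)) (≡⇒≡ᵇ n n refl))

isNSDistinctPartition⁻ : ∀ {m} xs → T (isNSDistinctPartition m xs) → T (isNSSubset m xs) × sum xs ≡ m
isNSDistinctPartition⁻ {m} xs p =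
  let inc , rest      = T-∧⁻ {strictInc xs} p
      bounded , rest′ = T-∧⁻ {inRange m xs} rest
      sum≡m , ns      = T-∧⁻ {sum xs ≡ᵇ m} rest′
  in isNSSubset⁺ xs inc (inRange⁻ xs bounded) ns , ≡ᵇ⇒≡ (sum xs) m sum≡m

isNSDistinctPartition⁺ : ∀ {m} xs → T (isNSSubset m xs) → sum xs ≡ m → T (isNSDistinctPartition m xs)
isNSDistinctPartition⁺ {m} xs p sum≡m =
  let inc , bounds , ns = isNSSubset⁻ xs p
  in T-∧⁺ {strictInc xs} (inc , T-∧⁺ {inRange m xs} (inRange⁺ xs bounds ,
       T-∧⁺ {sum xs ≡ᵇ m} (≡⇒≡ᵇ (sum xs) m sum≡m , ns)))

isNSDistinctPartition-∷ʳ⁻ : ∀ {m} ys {z} → T (isNSDistinctPartition m (ys ∷ʳ z)) → Stack ys z × sum ys + z ≡ m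
isNSDistinctPartition-∷ʳ⁻ ys {z} p =
  let sub , sum≡m = isNSDistinctPartition⁻ (ys ∷ʳ z) p
  in proj₁ (isNSSubset-∷ʳ⁻ ys sub) , trans (sym (sum-∷ʳ ys z)) sum≡m

isNSDistinctPartition-∷ʳ⁺ : ∀ {m ys z} → Stack ys z → sum ys + z ≡ m → T (isNSDistinctPartition m (ys ∷ʳ z))
isNSDistinctPartition-∷ʳ⁺ {ys = ys} {z} s sum≡m =
  isNSDistinctPartition⁺ (ys ∷ʳ z) (isNSSubset-∷ʳ⁺ s (subst (z ≤_) sum≡m (m≤n+m z (sum ys))))
                         (trans (sum-∷ʳ ys z) sum≡m)

increasing⇒⊆oneTo : ∀ n {xs} → T (strictInc xs) → All (InRange n) xs → xs ⊆ oneTo n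
increasing⇒⊆oneTo zero    {[]}    _ _                   = []
increasing⇒⊆oneTo zero    {x ∷ _} _ ((1≤x , x≤0) ∷ _) = ⊥-elim (<⇒≱ 1≤x x≤0)
increasing⇒⊆oneTo (suc m) {xs}    inc bounds with initLast xs
... | []       = minimum (oneTo (suc m))
... | ys ∷ʳ′ z with ys-bounds , (1≤z , z≤1+m) ← All.∷ʳ⁻ {xs = ys} bounds
                 | ys-inc , ys<z ← strictInc-∷ʳ⁻ ys inc =
  subst (ys ∷ʳ z ⊆_) (applyUpTo-∷ʳ suc m) (by-top (m≤n⇒m<n∨m≡n z≤1+m))
  where
  ys≤m : All (InRange m) ys
  ys≤m = All.zipWith (λ ((1≤y , _) , y<z) → 1≤y , ≤-pred (<-≤-trans y<z z≤1+m)) (ys-bounds , ys<z)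
  by-top : z < suc m ⊎ z ≡ suc m → ys ∷ʳ z ⊆ oneTo m ∷ʳ suc m
  by-top (inj₁ z<1+m) = ++⁺ʳ _ (increasing⇒⊆oneTo m inc (All.∷ʳ⁺ ys≤m (1≤z , ≤-pred z<1+m)))
  by-top (inj₂ refl)  = ++⁺ (increasing⇒⊆oneTo m ys-inc ys≤m) (refl ∷ [])

sublists-oneTo-enumerates : ∀ n P → (∀ xs → T (P xs) → T (isNSSubset n xs)) → Enumerates P (sublists (oneTo n))
sublists-oneTo-enumerates n P P⇒ = record
  { unique   = sublists-unique (oneTo-unique n)
  ; complete = λ {xs} p → let inc , bounds , _ = isNSSubset⁻ xs (P⇒ xs p)
                          in ⊆⇒∈-sublists (increasing⇒⊆oneTo n inc bounds)
  }

isTopNSSubset⇒isNSSubset : ∀ {n} xs → T (isTopNSSubset n xs) → T (isNSSubset n xs)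
isTopNSSubset⇒isNSSubset {n} xs = proj₁ ∘ T-∧⁻ {isNSSubset n xs}

isNSSubset-suc⁻ : ∀ {m} xs → T (isNSSubset (suc m) xs) → T (isNSSubset m xs) ⊎ T (isTopNSSubset (suc m) xs)
isNSSubset-suc⁻ xs p with initLast xs
... | []       = inj₁ _
... | ys ∷ʳ′ z with s , z≤1+m ← isNSSubset-∷ʳ⁻ ys p with m≤n⇒m<n∨m≡n z≤1+m
...   | inj₁ z<1+m = inj₁ (isNSSubset-∷ʳ⁺ s (≤-pred z<1+m))
...   | inj₂ refl  = inj₂ (isTopNSSubset-∷ʳ⁺ s)

isNSSubset⇒¬isTopNSSubset-suc : ∀ {m} xs → T (isNSSubset m xs) → ¬ T (isTopNSSubset (suc m) xs)
isNSSubset⇒¬isTopNSSubset-suc xs p top with initLast xs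
... | []       = top
... | ys ∷ʳ′ z = <-irrefl (proj₂ (isTopNSSubset-∷ʳ⁻ ys top)) (s≤s (proj₂ (isNSSubset-∷ʳ⁻ ys p)))

f-suc : ∀ m → f (suc m) ≡ f m + length (filterᵇ (isTopNSSubset (suc m)) (sublists (oneTo (suc m))))
f-suc m = begin
  f (suc m)                                              ≡⟨ split ⟩
  length (filterᵇ (isNSSubset m) L) + #top               ≡⟨ cong (_+ #top) shrink ⟩
  f m + #top                                             ∎
  where
  open ≡-Reasoning
  L    = sublists (oneTo (suc m))
  #top = length (filterᵇ (isTopNSSubset (suc m)) L)
  split : f (suc m) ≡ length (filterᵇ (isNSSubset m) L) + #top
  split = length-filter-⊎ (isNSSubset (suc m)) (isNSSubset m) (isTopNSSubset (suc m))
            isNSSubset-suc⁻ (isNSSubset-mono (n≤1+n m)) isTopNSSubset⇒isNSSubset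
            isNSSubset⇒¬isTopNSSubset-suc L
  shrink : length (filterᵇ (isNSSubset m) L) ≡ f m
  shrink = length-filter-cong
    (sublists-oneTo-enumerates (suc m) (isNSSubset m) (isNSSubset-mono (n≤1+n m)))
    (sublists-oneTo-enumerates m (isNSSubset m) (λ _ p → p))
    (↔-id _)

m≤n⇒n≤2*n∸m : ∀ {m n} → m ≤ n → n ≤ 2 * n ∸ m
m≤n⇒n≤2*n∸m {m} {n} m≤n = ≤-trans (≤-reflexive (sym 2n∸n≡n)) (∸-monoʳ-≤ (2 * n) m≤n)
  where
  2n∸n≡n : 2 * n ∸ n ≡ n
  2n∸n≡n = trans (cong (_∸ n) (2*n≡n+n n)) (m+n∸m≡n n n)

module _ (n : ℕ) where

  toPartition : List ℕ → List ℕ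
  toPartition = replaceLast (λ ys → 2 * n ∸ sum ys)

  toSubset : List ℕ → List ℕ
  toSubset = replaceLast (const n)

  toPartition-valid : ∀ xs → T (isTopNSSubset n xs) → T (isNSDistinctPartition (2 * n) (toPartition xs))
  -- Matching on initLast xs also reduces toPartition xs, which is defined through the same view.
  toPartition-valid xs p with initLast xs
  ... | []       = ⊥-elim p
  ... | ys ∷ʳ′ z with s , refl ← isTopNSSubset-∷ʳ⁻ ys p =
    isNSDistinctPartition-∷ʳ⁺ (Stack-mono s (m≤n⇒n≤2*n∸m carries)) (m+[n∸m]≡n (≤-trans carries (m≤m+n n (n + 0))))
    where open Stack s

  toSubset-valid : 1 ≤ n → ∀ xs → T (isNSDistinctPartition (2 * n) xs) → T (isTopNSSubset n (toSubset xs))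
  toSubset-valid 1≤n xs p with initLast xs
  ... | []       = <⇒≢ (≤-trans 1≤n (m≤m+n n (n + 0))) (proj₂ (isNSDistinctPartition⁻ [] p))
  ... | ys ∷ʳ′ w with s , sum≡2n ← isNSDistinctPartition-∷ʳ⁻ ys p =
    isTopNSSubset-∷ʳ⁺ (Stack-halve s sum≡2n)

  toSubset∘toPartition : ∀ xs → T (isTopNSSubset n xs) → toSubset (toPartition xs) ≡ xs
  toSubset∘toPartition xs p with initLast xs
  ... | []       = refl
  ... | ys ∷ʳ′ z with _ , refl ← isTopNSSubset-∷ʳ⁻ ys p = replaceLast-∷ʳ (const n) ys (2 * n ∸ sum ys)

  toPartition∘toSubset : ∀ xs → T (isNSDistinctPartition (2 * n) xs) → toPartition (toSubset xs) ≡ xs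
  toPartition∘toSubset xs p with initLast xs
  ... | []       = refl
  ... | ys ∷ʳ′ w with _ , sum≡2n ← isNSDistinctPartition-∷ʳ⁻ ys p =
    trans (replaceLast-∷ʳ (λ ys → 2 * n ∸ sum ys) ys n)
          (cong (ys ∷ʳ_) (trans (cong (_∸ sum ys) (sym sum≡2n)) (m+n∸m≡n (sum ys) w)))

  top↔partition : 1 ≤ n → TopNSSubset n ↔ NSDistinctPartition (2 * n)
  top↔partition 1≤n = mk↔ₛ′ to from
    (λ (xs , p) → ≡-subtype (toPartition∘toSubset xs p))
    (λ (xs , p) → ≡-subtype (toSubset∘toPartition xs p))
    where
    to : TopNSSubset n → NSDistinctPartition (2 * n)
    to (xs , p) = toPartition xs , toPartition-valid xs p
    from : NSDistinctPartition (2 * n) → TopNSSubset n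
    from (xs , p) = toSubset xs , toSubset-valid 1≤n xs p

  #top≡b : 1 ≤ n → length (filterᵇ (isTopNSSubset n) (sublists (oneTo n))) ≡ b (2 * n)
  #top≡b 1≤n = length-filter-cong
    (sublists-oneTo-enumerates n (isTopNSSubset n) isTopNSSubset⇒isNSSubset)
    (sublists-oneTo-enumerates (2 * n) (isNSDistinctPartition (2 * n)) (λ xs → proj₁ ∘ isNSDistinctPartition⁻ xs))
    (top↔partition 1≤n)

theorem6 : (n : ℕ) → 1 ≤ n →
    (TopNSSubset n ⤖ NSDistinctPartition (2 * n)) × (f n ≡ f (n ∸ 1) + b (2 * n))
theorem6 n@(suc m) 1≤n = ↔⇒⤖ (top↔partition n 1≤n) , trans (f-suc m) (cong (f m +_) (#top≡b n 1≤n))
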